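{- Let $G$ be an infinite abelian group and $A\subset G$ a weak basis of $G$ (i.e. $\bigcup_{i=1}^h iA\sim G$ for some positive integer $h$). Then $A$ is a basis of $G$ (i.e. $kA\sim G$ for some positive integer $k$) if and only if $\langle A-A\rangle=G$.
   Context: $iA$ is the set of sums of $i$ not necessarily distinct elements of $A$; $X\sim Y$ means finite symmetric difference; $A-A=\{a_1-a_2:a_1,a_2\in A\}$ and $\langle A-A\rangle$ is the subgroup of $G$ it generates. -}

module Defs where

open import Level using (Level; _⊔_)
open import Data.Nat using (ℕ; suc; _≤_)
open import Data.Vec using (Vec; foldr)
open import Data.Vec.Relation.Unary.All using (All)
open import Data.List using (List)
open import Data.List.Relation.Unary.Any using (Any)
open import Data.Product using (Σ; ∃; ∃-syntax; _×_; _,_)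
open import Relation.Nullary using (¬_)
open import Algebra.Bundles using (AbelianGroup)

module _ {c ℓ : Level} (G : AbelianGroup c ℓ) where
  open AbelianGroup G

  Subset : (ℓ' : Level) → Set (c ⊔ Level.suc ℓ')
  Subset ℓ' = Carrier → Set ℓ'

  _∈L_ : Carrier → List Carrier → Set (c ⊔ ℓ)
  x ∈L L = Any (x ≈_) L

  Infinite : Set (c ⊔ ℓ)
  Infinite = (L : List Carrier) → ∃[ x ] ¬ (x ∈L L)

  -- X ∼ Y : the symmetric difference of X and Y is finite, i.e. contained in
  -- some finite list L: outside L, X and Y agree.
  _∼_ : ∀ {ℓ₁ ℓ₂} → Subset ℓ₁ → Subset ℓ₂ → Set (c ⊔ ℓ ⊔ ℓ₁ ⊔ ℓ₂)
  X ∼ Y = ∃[ L ] ((x : Carrier) → ¬ (x ∈L L) → (X x → Y x) × (Y x → X x))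

  Whole : Subset Level.zero
  Whole _ = Data.Unit.⊤
    where import Data.Unit

  sumV : ∀ {n} → Vec Carrier n → Carrier
  sumV = foldr _ _∙_ ε

  sumset : ∀ {ℓ'} → ℕ → Subset ℓ' → Subset (c ⊔ ℓ ⊔ ℓ')
  sumset i A x = Σ (Vec Carrier i) λ v → All A v × (x ≈ sumV v)

  unionSumsets : ∀ {ℓ'} → ℕ → Subset ℓ' → Subset (c ⊔ ℓ ⊔ ℓ')
  unionSumsets h A x = Σ ℕ λ i → (1 ≤ i) × (i ≤ h) × sumset i A x

  diffset : ∀ {ℓ'} → Subset ℓ' → Subset (c ⊔ ℓ ⊔ ℓ')
  diffset A x = Σ Carrier λ a₁ → Σ Carrier λ a₂ → A a₁ × A a₂ × (x ≈ a₁ - a₂)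

  data Generated {ℓ'} (S : Subset ℓ') : Carrier → Set (c ⊔ ℓ ⊔ ℓ') where
    gen  : ∀ {x} → S x → Generated S x
    unit : Generated S ε
    mul  : ∀ {x y} → Generated S x → Generated S y → Generated S (x ∙ y)
    inv  : ∀ {x} → Generated S x → Generated S (x ⁻¹)
    resp : ∀ {x y} → x ≈ y → Generated S x → Generated S y

  WeakBasis : ∀ {ℓ'} → Subset ℓ' → Set (c ⊔ ℓ ⊔ ℓ')
  WeakBasis A = ∃[ h ] (1 ≤ h) × (unionSumsets h A ∼ Whole)

  Basis : ∀ {ℓ'} → Subset ℓ' → Set (c ⊔ ℓ ⊔ ℓ')
  Basis A = ∃[ k ] (1 ≤ k) × (sumset k A ∼ Whole)

  GeneratesDiff : ∀ {ℓ'} → Subset ℓ' → Set (c ⊔ ℓ ⊔ ℓ')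
  GeneratesDiff A = (x : Carrier) → Generated (diffset A) x

module Submission where

-- Two descriptions drive the proof.  First, ⟨A − A⟩ is exactly the set of
-- differences s − t with s, t in a common sumset mA.  Second, a set S ∼ G is
-- the same as a cofinite set: it contains everything outside a finite list,
-- and cofinite sets are closed under translation and finite intersection and,
-- since G is infinite, are non-empty.
--
-- (⇒) If kA is cofinite, so is kA ∩ (kA − x); any y in it gives
--     x = (y + x) − y, a difference of two elements of kA.
-- (⇐) A weak basis is non-empty; pick a ∈ A.  Writing −a = s − t with
--     s, t ∈ mA gives t = s + a, so t lies in both mA and (m+1)A.  Hence
--     h·t ∈ (hm + r)A for every r ≤ h.  If ⋃_{i≤h} iA is cofinite then so is
--     its translate by h·t, and every x in that translate is
--     (x − h·t) + h·t ∈ jA + (hm + h − j)A = (hm + h)A, so (hm + h)A ∼ G.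

open import Defs
open import Level using (Level; _⊔_)
open import Data.Product using (_×_; _,_; ∃; ∃-syntax; proj₂)
open import Data.Unit using (tt)
open import Data.Nat using (ℕ; zero; suc; _+_; _*_; _∸_; _≤_; z≤n; s≤s)
open import Data.Nat.Properties using (+-assoc; +-suc; +-commutativeSemigroup; m+[n∸m]≡n; m∸n≤m; m≤n+m; ≤-trans)
open import Data.Vec using (Vec; []; _∷_; _++_)
open import Data.Vec.Relation.Unary.All using (All; []; _∷_)
open import Data.Vec.Relation.Unary.All.Properties using (++⁺)
open import Data.List as List using (List)
open import Data.List.Relation.Unary.Any as Any using ()
open import Data.List.Relation.Unary.Any.Properties using (map⁺; ++⁺ˡ; ++⁺ʳ)
open import Relation.Binary.PropositionalEquality as ≡ using (_≡_)
open import Relation.Nullary using (¬_)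
open import Algebra.Bundles using (AbelianGroup)
import Algebra.Definitions.RawMonoid as RawMonoidDefinitions
import Algebra.Properties.AbelianGroup as AbelianGroupProperties
import Algebra.Properties.CommutativeSemigroup as CommutativeSemigroupProperties
import Algebra.Properties.Group as GroupProperties
import Relation.Binary.Reasoning.Setoid as SetoidReasoning

-- Splitting h into j and h − j inside a sum of sumset sizes.
complement-size : ∀ n {j h} → j ≤ h → j + (n + (h ∸ j)) ≡ n + h
complement-size n {j} {h} j≤h =
  ≡.trans (x∙yz≈y∙xz j n (h ∸ j)) (≡.cong (n +_) (m+[n∸m]≡n j≤h))
  where open CommutativeSemigroupProperties +-commutativeSemigroup using (x∙yz≈y∙xz)

module _ {c ℓ : Level} (G : AbelianGroup c ℓ) where
  open AbelianGroup G
  open GroupProperties group using (//-cong₂; //-rightDividesˡ; //-rightDividesʳ; \\-leftDividesˡ; \\-leftDividesʳ)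
  open AbelianGroupProperties G using (xyx⁻¹≈y; ⁻¹-∙-comm)
  open CommutativeSemigroupProperties commutativeSemigroup using (interchange)
  open RawMonoidDefinitions rawMonoid using () renaming (_×_ to _·_)

  Cofinite : ∀ {ℓ₁} → Subset G ℓ₁ → Set (c ⊔ ℓ ⊔ ℓ₁)
  Cofinite S = ∃[ L ] ((x : Carrier) → ¬ (_∈L_ G x L) → S x)

  ∼Whole⇒cofinite : ∀ {ℓ₁} {X : Subset G ℓ₁} → _∼_ G X (Whole G) → Cofinite X
  ∼Whole⇒cofinite (L , agree) = L , λ x x∉L → proj₂ (agree x x∉L) tt

  cofinite⇒∼Whole : ∀ {ℓ₁} {X : Subset G ℓ₁} → Cofinite X → _∼_ G X (Whole G)
  cofinite⇒∼Whole (L , inX) = L , λ x x∉L → (λ _ → tt) , (λ _ → inX x x∉L)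

  cofinite-inhabited : ∀ {ℓ₁} {S : Subset G ℓ₁} → Infinite G → Cofinite S → ∃ S
  cofinite-inhabited infinite (L , inS) with infinite L
  ... | x , x∉L = x , inS x x∉L

  cofinite-∩ : ∀ {ℓ₁ ℓ₂} {S : Subset G ℓ₁} {T : Subset G ℓ₂} →
               Cofinite S → Cofinite T → Cofinite (λ x → S x × T x)
  cofinite-∩ (L , inS) (M , inT) =
    L List.++ M , λ x x∉ → inS x (λ p → x∉ (++⁺ˡ p)) , inT x (λ p → x∉ (++⁺ʳ L p))

  cofinite-translate : ∀ {ℓ₁} {S : Subset G ℓ₁} (g : Carrier) →
                       Cofinite S → Cofinite (λ x → S (x ∙ g))
  cofinite-translate g (L , inS) =
    List.map (_- g) L , λ x x∉ → inS (x ∙ g) (λ p → x∉ (map⁺ (Any.map (shift x) p)))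
    where
    shift : ∀ x {l} → x ∙ g ≈ l → x ≈ l - g
    shift x x∙g≈l = trans (sym (//-rightDividesʳ g x)) (∙-congʳ x∙g≈l)

  module _ {ℓ' : Level} (A : Subset G ℓ') where
    open SetoidReasoning setoid

    sumset-resp : ∀ {k x y} → x ≈ y → sumset G k A x → sumset G k A y
    sumset-resp x≈y (v , v∈A , x≈Σv) = v , v∈A , trans (sym x≈y) x≈Σv

    sumset-zero : sumset G 0 A ε
    sumset-zero = [] , [] , refl

    sumset-single : ∀ {a} → A a → sumset G 1 A a
    sumset-single {a} a∈A = a ∷ [] , a∈A ∷ [] , sym (identityʳ a)

    sumV-++ : ∀ {m n} (u : Vec Carrier m) (v : Vec Carrier n) →
              sumV G (u ++ v) ≈ sumV G u ∙ sumV G v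
    sumV-++ []      v = sym (identityˡ _)
    sumV-++ (a ∷ u) v = trans (∙-congˡ (sumV-++ u v)) (sym (assoc a _ _))

    sumset-add : ∀ {m n x y} → sumset G m A x → sumset G n A y → sumset G (m + n) A (x ∙ y)
    sumset-add (u , u∈A , x≈Σu) (v , v∈A , y≈Σv) =
      u ++ v , ++⁺ u∈A v∈A , trans (∙-cong x≈Σu y≈Σv) (sym (sumV-++ u v))

    sumset-cast : ∀ {k k′ x} → k ≡ k′ → sumset G k A x → sumset G k′ A x
    sumset-cast = ≡.subst (λ k → sumset G k A _)

    sumsetDiff⇒generated : ∀ {k s t} → sumset G k A s → sumset G k A t →
                           Generated G (diffset G A) (s - t)
    sumsetDiff⇒generated (u , u∈A , s≈Σu) (v , v∈A , t≈Σv) =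
      resp (//-cong₂ (sym s≈Σu) (sym t≈Σv)) (vectorDiff u v u∈A v∈A)
      where
      vectorDiff : ∀ {k} (u v : Vec Carrier k) → All A u → All A v →
                   Generated G (diffset G A) (sumV G u - sumV G v)
      vectorDiff []      []      _           _           = resp (sym (inverseʳ ε)) unit
      vectorDiff (a ∷ u) (b ∷ v) (a∈A ∷ u∈A) (b∈A ∷ v∈A) =
        resp split (mul (gen (a , b , a∈A , b∈A , refl)) (vectorDiff u v u∈A v∈A))
        where
        split : (a - b) ∙ (sumV G u - sumV G v) ≈ (a ∙ sumV G u) - (b ∙ sumV G v)
        split = begin
          (a - b) ∙ (sumV G u - sumV G v)           ≈⟨ interchange a (b ⁻¹) _ _ ⟩
          (a ∙ sumV G u) ∙ (b ⁻¹ ∙ sumV G v ⁻¹)     ≈⟨ ∙-congˡ (⁻¹-∙-comm b _) ⟩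
          (a ∙ sumV G u) - (b ∙ sumV G v)           ∎

    record SumsetDifference (g : Carrier) : Set (c ⊔ ℓ ⊔ ℓ') where
      constructor difference
      field
        m            : ℕ
        plus minus   : Carrier
        plus∈mA      : sumset G m A plus
        minus∈mA     : sumset G m A minus
        g+minus≈plus : g ∙ minus ≈ plus

    -- Conversely, every element of ⟨A − A⟩ is such a difference: the
    -- differences of elements of common sumsets contain A − A and ε and are
    -- closed under ∙ (add the sumsets), ⁻¹ (swap the two terms) and ≈.
    generated⇒sumsetDiff : ∀ {g} → Generated G (diffset G A) g → SumsetDifference g
    generated⇒sumsetDiff (gen (a , b , a∈A , b∈A , g≈a-b)) =
      difference 1 a b (sumset-single a∈A) (sumset-single b∈A)
        (trans (∙-congʳ g≈a-b) (//-rightDividesˡ b a))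
    generated⇒sumsetDiff unit = difference 0 ε ε sumset-zero sumset-zero (identityˡ ε)
    generated⇒sumsetDiff (mul {x} {y} gx gy)
      with generated⇒sumsetDiff gx | generated⇒sumsetDiff gy
    ... | difference m s t s∈ t∈ x+t≈s | difference n s′ t′ s′∈ t′∈ y+t′≈s′ =
      difference (m + n) (s ∙ s′) (t ∙ t′) (sumset-add s∈ s′∈) (sumset-add t∈ t′∈)
        (trans (interchange x y t t′) (∙-cong x+t≈s y+t′≈s′))
    generated⇒sumsetDiff (inv {x} gx) with generated⇒sumsetDiff gx
    ... | difference m s t s∈ t∈ x+t≈s =
      difference m t s t∈ s∈ (trans (∙-congˡ (sym x+t≈s)) (\\-leftDividesʳ x t))
    generated⇒sumsetDiff (resp x≈y gx) with generated⇒sumsetDiff gx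
    ... | difference m s t s∈ t∈ x+t≈s =
      difference m s t s∈ t∈ (trans (∙-congʳ (sym x≈y)) x+t≈s)

    record Straddle : Set (c ⊔ ℓ ⊔ ℓ') where
      constructor straddle
      field
        m        : ℕ
        center   : Carrier
        ∈mA      : sumset G m A center
        ∈[1+m]A  : sumset G (suc m) A center

    -- If a ∈ A and −a ∈ ⟨A − A⟩, say −a + t = s with s, t ∈ mA, then
    -- t = a + s ∈ (1+m)A, so t straddles mA and (m+1)A.
    straddle-from : ∀ {a} → A a → Generated G (diffset G A) (a ⁻¹) → Straddle
    straddle-from {a} a∈A −a∈⟨A−A⟩ with generated⇒sumsetDiff −a∈⟨A−A⟩
    ... | difference m s t s∈mA t∈mA −a+t≈s =
      straddle m t t∈mA (sumset-resp a+s≈t (sumset-add (sumset-single a∈A) s∈mA))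
      where
      a+s≈t : a ∙ s ≈ t
      a+s≈t = trans (∙-congˡ (sym −a+t≈s)) (\\-leftDividesˡ a t)

    -- If c ∈ mA ∩ (m+1)A then n·c ∈ (nm + r)A for every r ≤ n: take r copies
    -- of c from (m+1)A and the remaining n − r copies from mA.
    multiple-∈ : ∀ {m c} → sumset G m A c → sumset G (suc m) A c →
                 ∀ n r → r ≤ n → sumset G (n * m + r) A (n · c)
    multiple-∈ {m} {c} c∈mA c∈[1+m]A = go
      where
      go : ∀ n r → r ≤ n → sumset G (n * m + r) A (n · c)
      go zero    zero    z≤n       = sumset-zero
      go (suc n) zero    z≤n       =
        sumset-cast (≡.sym (+-assoc m (n * m) 0))
          (sumset-add c∈mA (go n zero z≤n))
      go (suc n) (suc r) (s≤s r≤n) =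
        sumset-cast (≡.sym (≡.trans (+-suc (m + n * m) r) (≡.cong suc (+-assoc m (n * m) r))))
          (sumset-add c∈[1+m]A (go n r r≤n))

    -- (⇒) If kA ∼ G, pick y with y ∈ kA and y + x ∈ kA; then x = (y + x) − y.
    basis⇒generatesDiff : Infinite G → Basis G A → GeneratesDiff G A
    basis⇒generatesDiff infinite (k , _ , kA∼G) x
      with cofinite-inhabited infinite
             (cofinite-∩ (∼Whole⇒cofinite kA∼G) (cofinite-translate x (∼Whole⇒cofinite kA∼G)))
    ... | y , y∈kA , y+x∈kA = resp (xyx⁻¹≈y y x) (sumsetDiff⇒generated y+x∈kA y∈kA)

    -- (⇐) With c straddling mA and (m+1)A, the translate of the cofinite set
    -- ⋃_{1≤i≤h} iA by h·c lies in (hm + h)A.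
    weakBasis-shift : (st : Straddle) → ∀ h → Cofinite (unionSumsets G h A) →
                      Cofinite (sumset G (h * Straddle.m st + h) A)
    weakBasis-shift (straddle m c c∈mA c∈[1+m]A) h union-cofinite =
      let L , inShifted = cofinite-translate ((h · c) ⁻¹) union-cofinite in
      L , λ x x∉L → shifted x (inShifted x x∉L)
      where
      shifted : ∀ x → unionSumsets G h A (x - h · c) → sumset G (h * m + h) A x
      shifted x (j , _ , j≤h , x-hc∈jA) =
        sumset-resp (//-rightDividesˡ (h · c) x)
          (sumset-cast (complement-size (h * m) j≤h)
            (sumset-add x-hc∈jA (multiple-∈ c∈mA c∈[1+m]A h (h ∸ j) (m∸n≤m h j))))

    -- In an infinite group, A is non-empty once some ⋃_{1≤i≤h} iA is cofinite:
    -- that union has an element, which is a sum of i ≥ 1 elements of A.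
    union-cofinite⇒inhabited : Infinite G → ∀ h → Cofinite (unionSumsets G h A) → ∃ A
    union-cofinite⇒inhabited infinite h union-cofinite
      with cofinite-inhabited infinite union-cofinite
    ... | _ , zero  , () , _
    ... | _ , suc _ , _ , _ , (a ∷ _ , a∈A ∷ _ , _) = a , a∈A

    generatesDiff⇒basis : Infinite G → WeakBasis G A → GeneratesDiff G A → Basis G A
    generatesDiff⇒basis infinite (h , 1≤h , union∼G) ⟨A−A⟩≡G
      with union-cofinite⇒inhabited infinite h (∼Whole⇒cofinite union∼G)
    ... | a , a∈A =
      h * Straddle.m st + h , ≤-trans 1≤h (m≤n+m h _) ,
      cofinite⇒∼Whole (weakBasis-shift st h (∼Whole⇒cofinite union∼G))
      where
      st : Straddle
      st = straddle-from a∈A (⟨A−A⟩≡G (a ⁻¹))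

lemma2p7 : {c ℓ ℓ' : Level} (G : AbelianGroup c ℓ) (A : Subset G ℓ') →
    Infinite G → WeakBasis G A →
    (Basis G A → GeneratesDiff G A) × (GeneratesDiff G A → Basis G A)
lemma2p7 G A infinite weakBasis =
  basis⇒generatesDiff G A infinite , generatesDiff⇒basis G A infinite weakBasis
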